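{- Let $k\ge 1$, $n=2k$, and let $\mathcal{C}\subseteq\mathcal{S}_n$ be the conjugacy class of fixed-point-free involutions, i.e. of cycle type $(2^k)$. Then there is no $\pi\in\mathcal{C}$ with $\mathrm{maj}(\pi)=k+1$, and there is no $\pi\in\mathcal{C}$ with $\mathrm{maj}(\pi)=\binom{n}{2}-1$.
   Context: For $\pi\in\mathcal{S}_n$, $\mathrm{Des}(\pi)=\{i\in\{1,\dots,n-1\}\mid \pi(i)>\pi(i+1)\}$ and $\mathrm{maj}(\pi)=\sum_{i\in\mathrm{Des}(\pi)} i$. -}

module Defs where

open import Data.Nat using (ℕ; zero; suc; _+_; _<_; _<?_)
open import Data.Fin using (Fin; toℕ; inject₁; fromℕ) renaming (suc to fsuc)
open import Data.Fin.Permutation using (Permutation′; _⟨$⟩ʳ_)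
open import Relation.Binary.PropositionalEquality using (_≡_; _≢_)
open import Relation.Nullary using (does)
open import Data.Bool using (if_then_else_)
open import Data.Product using (_×_)

val : ∀ {n} → Permutation′ n → Fin n → ℕ
val π j = toℕ (π ⟨$⟩ʳ j)

majSum : (m : ℕ) → (Fin m → ℕ) → ℕ
majSum zero    f = 0
majSum (suc m) f = majSum m (λ j → f (inject₁ j)) + f (fromℕ m)

-- Contribution of the 0-indexed position j (i = j+1, 1-indexed):
-- i if π(i) > π(i+1), else 0.
descentContribution : ∀ {m} → Permutation′ (suc m) → Fin m → ℕ
descentContribution π j =
  if does (val π (fsuc j) <? val π (inject₁ j)) then suc (toℕ j) else 0

maj : ∀ {n} → Permutation′ n → ℕ
maj {zero}  π = 0
maj {suc m} π = majSum m (descentContribution π)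

IsFPFInvolution : ∀ {n} → Permutation′ n → Set
IsFPFInvolution {n} π =
  (∀ (i : Fin n) → π ⟨$⟩ʳ (π ⟨$⟩ʳ i) ≡ i) × (∀ (i : Fin n) → π ⟨$⟩ʳ i ≢ i)

-- Read π as a function P on {0, …, m}, m = 2k − 1, where a descent at i
-- (P (i + 1) < P i) contributes i + 1 to maj.  A fixed-point-free involution
-- cannot map a point of an ascending run into the run (i and P i would be
-- ordered both ways), so a run of r positions ending at m takes r distinct
-- values below it and a run starting at 0 takes r values above it; either way
-- r ≤ k, hence π descends somewhere in {k − 1, …, m − 1} and in {0, …, k − 1}.
-- If maj = k + 1, the upper descent contributes at least k, which leaves only
-- the descents at k − 1 and 0 (so k ≥ 2); then P ascends on {k, …, m} through
-- the values 0, 1, …, so P 0 = k < k + 1 = P 1, contradicting the descent at 0.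
-- If maj = C(2k, 2) − 1, the non-descents contribute exactly 1, so P descends
-- exactly on {1, …, m − 1}; with j = P 0 ≥ 1 this gives P m ≤ P j = 0, so
-- P 0 = m, yet P 0 < P 1 ≤ m.

module Submission where

open import Defs
open import Algebra.Properties.CommutativeSemigroup using (interchange)
open import Data.Bool using (if_then_else_)
open import Data.Empty using (⊥; ⊥-elim)
open import Data.Fin using (Fin; toℕ; inject₁; fromℕ; fromℕ<) renaming (suc to fsuc)
open import Data.Fin.Permutation using (Permutation′; _⟨$⟩ʳ_)
open import Data.Fin.Properties using (toℕ-injective; toℕ<n; fromℕ<-toℕ; toℕ-fromℕ<; toℕ-inject₁; toℕ-fromℕ)
open import Data.Nat using (ℕ; zero; suc; _+_; _*_; _∸_; _≤_; _<_; _<?_; _≤?_; _≟_; z≤n; s≤s; z<s)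
open import Data.Nat.Combinatorics using (_C_; nC1≡n; nCk+nC[k+1]≡[n+1]C[k+1])
open import Data.Nat.Properties
open import Data.Product using (∃; _×_; _,_; proj₁; proj₂)
open import Data.Sum using (_⊎_; inj₁; inj₂)
open import Function using (_∘′_)
open import Relation.Binary using (tri<; tri≈; tri>)
open import Relation.Binary.PropositionalEquality
open import Relation.Nullary using (¬_; Dec; yes; no; does; contradiction)
open import Relation.Nullary.Decidable using (_×-dec_; dec-true; dec-false)

sumBelow : ℕ → (ℕ → ℕ) → ℕ
sumBelow zero    f = 0
sumBelow (suc m) f = sumBelow m f + f m

sumBelow-cong : ∀ m {f g} → (∀ {i} → i < m → f i ≡ g i) → sumBelow m f ≡ sumBelow m g
sumBelow-cong zero    f≗g = refl
sumBelow-cong (suc m) f≗g = cong₂ _+_ (sumBelow-cong m (f≗g ∘′ m<n⇒m<1+n)) (f≗g ≤-refl)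

sumBelow-+ : ∀ m f g → sumBelow m f + sumBelow m g ≡ sumBelow m (λ i → f i + g i)
sumBelow-+ zero    f g = refl
sumBelow-+ (suc m) f g = begin
  (sumBelow m f + f m) + (sumBelow m g + g m)
    ≡⟨ interchange +-commutativeSemigroup (sumBelow m f) (f m) (sumBelow m g) (g m) ⟩
  (sumBelow m f + sumBelow m g) + (f m + g m) ≡⟨ cong (_+ (f m + g m)) (sumBelow-+ m f g) ⟩
  sumBelow m (λ i → f i + g i) + (f m + g m)  ∎
  where open ≡-Reasoning

sumBelow-zero : ∀ m {f} → (∀ {i} → i < m → f i ≡ 0) → sumBelow m f ≡ 0
sumBelow-zero zero    f≗0 = refl
sumBelow-zero (suc m) f≗0 = cong₂ _+_ (sumBelow-zero m (f≗0 ∘′ m<n⇒m<1+n)) (f≗0 ≤-refl)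

sumBelow-single : ∀ m {f p} → p < m → (∀ {i} → i < m → i ≢ p → f i ≡ 0) → sumBelow m f ≡ f p
sumBelow-single (suc m) {f} {p} p<1+m f≗0 with m≤n⇒m<n∨m≡n (≤-pred p<1+m)
... | inj₁ p<m  = begin
  sumBelow m f + f m ≡⟨ cong₂ _+_ (sumBelow-single m p<m (λ i<m → f≗0 (m<n⇒m<1+n i<m)))
                                  (f≗0 ≤-refl (λ m≡p → <-irrefl (sym m≡p) p<m)) ⟩
  f p + 0            ≡⟨ +-identityʳ (f p) ⟩
  f p                ∎
  where open ≡-Reasoning
... | inj₂ refl = cong (_+ f p) (sumBelow-zero p (λ i<p → f≗0 (m<n⇒m<1+n i<p) (<⇒≢ i<p)))

term≤sumBelow : ∀ m f {p} → p < m → f p ≤ sumBelow m f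
term≤sumBelow (suc m) f {p} p<1+m with m≤n⇒m<n∨m≡n (≤-pred p<1+m)
... | inj₁ p<m  = ≤-trans (term≤sumBelow m f p<m) (m≤m+n (sumBelow m f) (f m))
... | inj₂ refl = m≤n+m (f p) (sumBelow m f)

twoTerms≤sumBelow : ∀ m f {p q} → p < m → q < m → p ≢ q → f p + f q ≤ sumBelow m f
twoTerms≤sumBelow (suc m) f {p} {q} p<1+m q<1+m p≢q
  with m≤n⇒m<n∨m≡n (≤-pred p<1+m) | m≤n⇒m<n∨m≡n (≤-pred q<1+m)
... | inj₁ p<m  | inj₁ q<m  =
  ≤-trans (twoTerms≤sumBelow m f p<m q<m p≢q) (m≤m+n (sumBelow m f) (f m))
... | inj₁ p<m  | inj₂ refl = +-monoˡ-≤ (f q) (term≤sumBelow m f p<m)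
... | inj₂ refl | inj₁ q<m  =
  subst (_≤ sumBelow m f + f p) (+-comm (f q) (f p)) (+-monoˡ-≤ (f p) (term≤sumBelow m f q<m))
... | inj₂ refl | inj₂ refl = contradiction refl p≢q

sumBelow-suc : ∀ m → sumBelow m suc ≡ suc m C 2
sumBelow-suc zero    = refl
sumBelow-suc (suc m) = begin
  sumBelow m suc + suc m     ≡⟨ cong (_+ suc m) (sumBelow-suc m) ⟩
  suc m C 2 + suc m          ≡⟨ +-comm (suc m C 2) (suc m) ⟩
  suc m + suc m C 2          ≡⟨ cong (_+ suc m C 2) (sym (nC1≡n (suc m))) ⟩
  suc m C 1 + suc m C 2      ≡⟨ nCk+nC[k+1]≡[n+1]C[k+1] (suc m) 1 ⟩
  suc (suc m) C 2            ∎
  where open ≡-Reasoning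

module FixedPointFreeInvolution (P : ℕ → ℕ) (m : ℕ)
  (bounded        : ∀ {i} → i ≤ m → P i ≤ m)
  (involutive     : ∀ {i} → i ≤ m → P (P i) ≡ i)
  (fixedPointFree : ∀ {i} → i ≤ m → P i ≢ i)
  where

  P-swap : ∀ {i j} → i ≤ m → P i ≡ j → P j ≡ i
  P-swap i≤m refl = involutive i≤m

  P-injective : ∀ {i j} → i ≤ m → j ≤ m → P i ≡ P j → i ≡ j
  P-injective i≤m j≤m Pi≡Pj = trans (sym (involutive i≤m)) (trans (cong P Pi≡Pj) (involutive j≤m))

  Descent : ℕ → Set
  Descent i = P (suc i) < P i

  descent? : ∀ i → Dec (Descent i)
  descent? i = P (suc i) <? P i

  ¬descent⇒ascent : ∀ {i} → suc i ≤ m → ¬ Descent i → P i < P (suc i)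
  ¬descent⇒ascent {i} 1+i≤m ¬d = ≤∧≢⇒< (≮⇒≥ ¬d) λ Pi≡P[1+i] →
    <-irrefl (P-injective (<⇒≤ 1+i≤m) 1+i≤m Pi≡P[1+i]) ≤-refl

  Ascending : ℕ → ℕ → Set
  Ascending lo hi = ∀ t → lo ≤ t → t < hi → P t < P (suc t)

  Descending : ℕ → ℕ → Set
  Descending lo hi = ∀ t → lo ≤ t → t < hi → Descent t

  ascending-gap : ∀ {lo hi i} → Ascending lo hi → ∀ e → lo ≤ i → i + e ≤ hi → P i + e ≤ P (i + e)
  ascending-gap {i = i} asc zero    _    _          =
    ≤-reflexive (trans (+-identityʳ (P i)) (cong P (sym (+-identityʳ i))))
  ascending-gap {lo} {hi} {i} asc (suc e) lo≤i i+1+e≤hi = begin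
    P i + suc e       ≡⟨ +-suc (P i) e ⟩
    suc (P i + e)     ≤⟨ s≤s (ascending-gap asc e lo≤i (≤-trans (+-monoʳ-≤ i (n≤1+n e)) i+1+e≤hi)) ⟩
    suc (P (i + e))   ≤⟨ asc (i + e) (≤-trans lo≤i (m≤m+n i e)) (subst (_≤ hi) (+-suc i e) i+1+e≤hi) ⟩
    P (suc (i + e))   ≡⟨ cong P (sym (+-suc i e)) ⟩
    P (i + suc e)     ∎
    where open ≤-Reasoning

  ascending-strict : ∀ {lo hi i j} → Ascending lo hi → lo ≤ i → i < j → j ≤ hi → P i < P j
  ascending-strict {i = i} {j} asc lo≤i i<j j≤hi = begin-strict
    P i               <⟨ m<m+n (P i) (m<n⇒0<n∸m i<j) ⟩
    P i + (j ∸ i)     ≤⟨ ascending-gap asc (j ∸ i) lo≤i (subst (_≤ _) (sym i+[j∸i]≡j) j≤hi) ⟩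
    P (i + (j ∸ i))   ≡⟨ cong P i+[j∸i]≡j ⟩
    P j               ∎
    where
    open ≤-Reasoning
    i+[j∸i]≡j : i + (j ∸ i) ≡ j
    i+[j∸i]≡j = m+[n∸m]≡n (<⇒≤ i<j)

  ascending-image-outside : ∀ {lo hi i} → Ascending lo hi → hi ≤ m → lo ≤ i → i ≤ hi →
                            P i < lo ⊎ hi < P i
  ascending-image-outside {lo} {hi} {i} asc hi≤m lo≤i i≤hi with P i <? lo | hi <? P i
  ... | yes Pi<lo | _         = inj₁ Pi<lo
  ... | no _      | yes hi<Pi = inj₂ hi<Pi
  ... | no Pi≮lo  | no hi≮Pi  = ⊥-elim (image-inside (≮⇒≥ Pi≮lo) (≮⇒≥ hi≮Pi))
    where
    i≤m : i ≤ m
    i≤m = ≤-trans i≤hi hi≤m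
    image-inside : lo ≤ P i → P i ≤ hi → ⊥
    image-inside lo≤Pi Pi≤hi with <-cmp i (P i)
    ... | tri< i<Pi _ _ = <-asym i<Pi
      (subst (P i <_) (involutive i≤m) (ascending-strict asc lo≤i i<Pi Pi≤hi))
    ... | tri≈ _ i≡Pi _ = fixedPointFree i≤m (sym i≡Pi)
    ... | tri> _ _ Pi<i = <-asym Pi<i
      (subst (_< P i) (involutive i≤m) (ascending-strict asc lo≤Pi Pi<i i≤hi))

  final-run-image : ∀ {lo i} → Ascending lo m → lo ≤ i → i ≤ m → P i < lo
  final-run-image asc lo≤i i≤m with ascending-image-outside asc ≤-refl lo≤i i≤m
  ... | inj₁ Pi<lo = Pi<lo
  ... | inj₂ m<Pi  = contradiction (bounded i≤m) (<⇒≱ m<Pi)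

  initial-run-image : ∀ {hi i} → Ascending 0 hi → hi ≤ m → i ≤ hi → hi < P i
  initial-run-image asc hi≤m i≤hi with ascending-image-outside asc hi≤m z≤n i≤hi
  ... | inj₁ ()
  ... | inj₂ hi<Pi = hi<Pi

  final-run-short : ∀ {lo d} → Ascending lo m → lo + d ≡ m → d < lo
  final-run-short {lo} {d} asc lo+d≡m = begin-strict
    d            ≤⟨ m≤n+m d (P lo) ⟩
    P lo + d     ≤⟨ ascending-gap asc d ≤-refl (≤-reflexive lo+d≡m) ⟩
    P (lo + d)   ≡⟨ cong P lo+d≡m ⟩
    P m          <⟨ final-run-image asc (subst (lo ≤_) lo+d≡m (m≤m+n lo d)) ≤-refl ⟩
    lo           ∎
    where open ≤-Reasoning

  initial-run-short : ∀ {d} → Ascending 0 d → d ≤ m → suc d + d ≤ m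
  initial-run-short {d} asc d≤m = begin
    suc d + d    ≤⟨ +-monoˡ-≤ d (initial-run-image asc d≤m z≤n) ⟩
    P 0 + d      ≤⟨ ascending-gap asc d z≤n ≤-refl ⟩
    P d          ≤⟨ bounded d≤m ⟩
    m            ∎
    where open ≤-Reasoning

  upper-half-run-values : ∀ {d j} → Ascending (suc d) m → suc d + d ≡ m → j ≤ d →
                          P (suc d + j) ≡ j
  upper-half-run-values {d} {j} asc half≡m j≤d = ≤-antisym Pa+j≤j j≤Pa+j
    where
    a+j≤m : suc d + j ≤ m
    a+j≤m = subst (suc d + j ≤_) half≡m (+-monoʳ-≤ (suc d) j≤d)
    a+j+[d∸j]≡m : suc d + j + (d ∸ j) ≡ m
    a+j+[d∸j]≡m = trans (+-assoc (suc d) j (d ∸ j)) (trans (cong (suc d +_) (m+[n∸m]≡n j≤d)) half≡m)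
    j≤Pa+j : j ≤ P (suc d + j)
    j≤Pa+j = ≤-trans (m≤n+m j (P (suc d))) (ascending-gap asc j ≤-refl a+j≤m)
    Pa+j≤j : P (suc d + j) ≤ j
    Pa+j≤j = +-cancelʳ-≤ (d ∸ j) _ _ (begin
      P (suc d + j) + (d ∸ j)     ≤⟨ ascending-gap asc (d ∸ j) (m≤m+n (suc d) j) (≤-reflexive a+j+[d∸j]≡m) ⟩
      P (suc d + j + (d ∸ j))     ≡⟨ cong P a+j+[d∸j]≡m ⟩
      P m                         ≤⟨ ≤-pred (final-run-image asc (subst (suc d ≤_) half≡m (m≤m+n (suc d) d)) ≤-refl) ⟩
      d                           ≡⟨ sym (m+[n∸m]≡n j≤d) ⟩
      j + (d ∸ j)                 ∎)
      where open ≤-Reasoning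

  descending-gap : ∀ {lo hi i} → Descending lo hi → ∀ e → lo ≤ i → i + e ≤ hi → P (i + e) ≤ P i
  descending-gap {i = i} desc zero    _    _          = ≤-reflexive (cong P (+-identityʳ i))
  descending-gap {lo} {hi} {i} desc (suc e) lo≤i i+1+e≤hi = begin
    P (i + suc e)     ≡⟨ cong P (+-suc i e) ⟩
    P (suc (i + e))   ≤⟨ <⇒≤ (desc (i + e) (≤-trans lo≤i (m≤m+n i e)) (subst (_≤ hi) (+-suc i e) i+1+e≤hi)) ⟩
    P (i + e)         ≤⟨ descending-gap desc e lo≤i (≤-trans (+-monoʳ-≤ i (n≤1+n e)) i+1+e≤hi) ⟩
    P i               ∎
    where open ≤-Reasoning

  upper-half-ascending⇒¬descent₀ : ∀ {d} → suc d + d ≡ m → 1 ≤ d → Ascending (suc d) m → ¬ Descent 0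
  upper-half-ascending⇒¬descent₀ {d} half≡m 1≤d asc descent₀ =
    <-asym (+-monoʳ-< (suc d) z<s) (subst₂ _<_ (P-swap a+1≤m (value 1≤d)) (P-swap a+0≤m (value z≤n)) descent₀)
    where
    value : ∀ {j} → j ≤ d → P (suc d + j) ≡ j
    value = upper-half-run-values asc half≡m
    a+0≤m : suc d + 0 ≤ m
    a+0≤m = subst (suc d + 0 ≤_) half≡m (+-monoʳ-≤ (suc d) z≤n)
    a+1≤m : suc d + 1 ≤ m
    a+1≤m = subst (suc d + 1 ≤_) half≡m (+-monoʳ-≤ (suc d) 1≤d)

  descending-tail⇒descent₀ : 1 ≤ m → Descending 1 m → Descent 0
  descending-tail⇒descent₀ 1≤m desc with descent? 0
  ... | yes descent₀ = descent₀
  ... | no ¬descent₀ = contradiction (begin-strict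
    m       ≡⟨ sym P0≡m ⟩
    P 0     <⟨ ¬descent⇒ascent 1≤m ¬descent₀ ⟩
    P 1     ≤⟨ bounded 1≤m ⟩
    m       ∎) (<-irrefl refl)
    where
    open ≤-Reasoning
    j : ℕ
    j = P 0
    j+[m∸j]≡m : j + (m ∸ j) ≡ m
    j+[m∸j]≡m = m+[n∸m]≡n (bounded z≤n)
    Pm≤0 : P m ≤ 0
    Pm≤0 = subst₂ _≤_ (cong P j+[m∸j]≡m) (involutive z≤n)
             (descending-gap desc (m ∸ j) (n≢0⇒n>0 (fixedPointFree z≤n)) (≤-reflexive j+[m∸j]≡m))
    P0≡m : P 0 ≡ m
    P0≡m = P-swap ≤-refl (n≤0⇒n≡0 Pm≤0)

  no-descent⇒ascending : ∀ {lo hi} → hi ≤ m → (∀ t → lo ≤ t → t < hi → ¬ Descent t) → Ascending lo hi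
  no-descent⇒ascending hi≤m none t lo≤t t<hi = ¬descent⇒ascent (≤-trans t<hi hi≤m) (none t lo≤t t<hi)

  descent-in-final-segment : ∀ {lo d} → lo + d ≡ m → lo ≤ d → ∃ λ i → i < m × lo ≤ i × Descent i
  descent-in-final-segment {lo} lo+d≡m lo≤d with anyUpTo? (λ i → lo ≤? i ×-dec descent? i) m
  ... | yes descent = descent
  ... | no ∄descent = contradiction (final-run-short ascending lo+d≡m) (≤⇒≯ lo≤d)
    where
    ascending : Ascending lo m
    ascending = no-descent⇒ascending ≤-refl λ t lo≤t t<m dt → ∄descent (t , t<m , lo≤t , dt)

  descent-in-initial-segment : ∀ {d} → d ≤ m → m ≤ d + d → ∃ λ i → i < d × Descent i
  descent-in-initial-segment {d} d≤m m≤d+d with anyUpTo? descent? d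
  ... | yes descent = descent
  ... | no ∄descent = contradiction (initial-run-short ascending d≤m) (<⇒≱ (s≤s m≤d+d))
    where
    ascending : Ascending 0 d
    ascending = no-descent⇒ascending d≤m λ t _ t<d dt → ∄descent (t , t<d , dt)

  descentTerm : ℕ → ℕ
  descentTerm i = if does (descent? i) then suc i else 0

  majorIndex : ℕ
  majorIndex = sumBelow m descentTerm

  descentTerm-descent : ∀ {i} → Descent i → descentTerm i ≡ suc i
  descentTerm-descent {i} di = cong (if_then suc i else 0) (dec-true (descent? i) di)

  descentTerm-¬descent : ∀ {i} → ¬ Descent i → descentTerm i ≡ 0
  descentTerm-¬descent {i} ¬di = cong (if_then suc i else 0) (dec-false (descent? i) ¬di)

  descentTerm≤ : ∀ i → descentTerm i ≤ suc i
  descentTerm≤ i with descent? i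
  ... | yes di  = ≤-reflexive (descentTerm-descent di)
  ... | no ¬di = subst (_≤ suc i) (sym (descentTerm-¬descent ¬di)) z≤n

  two-descents≤majorIndex : ∀ {p q} → p < m → q < m → p ≢ q → Descent p → Descent q →
                            suc p + suc q ≤ majorIndex
  two-descents≤majorIndex p<m q<m p≢q dp dq =
    subst₂ (λ x y → x + y ≤ majorIndex) (descentTerm-descent dp) (descentTerm-descent dq)
      (twoTerms≤sumBelow m descentTerm p<m q<m p≢q)

  module _ {c} (m≡c+1+c : m ≡ c + suc c) (maj≡c+2 : majorIndex ≡ suc (suc c)) where

    two-descents-sum≤c : ∀ {p q} → p < m → q < m → p ≢ q → Descent p → Descent q → p + q ≤ c
    two-descents-sum≤c {p} {q} p<m q<m p≢q dp dq = ≤-pred (≤-pred (begin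
      suc (suc (p + q))   ≡⟨ cong suc (sym (+-suc p q)) ⟩
      suc p + suc q       ≤⟨ two-descents≤majorIndex p<m q<m p≢q dp dq ⟩
      majorIndex          ≡⟨ maj≡c+2 ⟩
      suc (suc c)         ∎))
      where open ≤-Reasoning

    c<m : c < m
    c<m = subst (c <_) (sym m≡c+1+c) (m<m+n c z<s)

    1+c≤m : suc c ≤ m
    1+c≤m = subst (suc c ≤_) (sym m≡c+1+c) (m≤n+m (suc c) c)

    descent-at-c : Descent c
    descent-at-c with descent-in-final-segment (sym m≡c+1+c) (n≤1+n c)
                    | descent-in-initial-segment 1+c≤m (subst (_≤ suc c + suc c) (sym m≡c+1+c) (n≤1+n _))
    ... | i , i<m , c≤i , di | j , j<1+c , dj = subst Descent (≤-antisym i≤c c≤i) di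
      where
      i≤c : i ≤ c
      i≤c with j ≟ i
      ... | yes refl = ≤-pred j<1+c
      ... | no j≢i   = ≤-trans (m≤n+m i j) (two-descents-sum≤c (≤-trans j<1+c 1+c≤m) i<m j≢i dj di)

    other-descent-at-0 : ∀ {t} → t < m → t ≢ c → Descent t → t ≡ 0
    other-descent-at-0 t<m t≢c dt =
      n≤0⇒n≡0 (+-cancelʳ-≤ _ _ 0 (two-descents-sum≤c t<m c<m t≢c dt descent-at-c))

    only-descent-at-c-impossible : (∀ {t} → t < m → t ≢ c → ¬ Descent t) → ⊥
    only-descent-at-c-impossible no-other = 1+n≢n (begin
      suc (suc c)         ≡⟨ sym maj≡c+2 ⟩
      majorIndex          ≡⟨ sumBelow-single m c<m (λ t<m t≢c → descentTerm-¬descent (no-other t<m t≢c)) ⟩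
      descentTerm c       ≡⟨ descentTerm-descent descent-at-c ⟩
      suc c               ∎)
      where open ≡-Reasoning

    1≤c : 1 ≤ c
    1≤c = n≢0⇒n>0 λ c≡0 →
      only-descent-at-c-impossible λ t<m t≢c dt → t≢c (trans (other-descent-at-0 t<m t≢c dt) (sym c≡0))

    descent-at-0 : Descent 0
    descent-at-0 with descent? 0
    ... | yes d0 = d0
    ... | no ¬d0 = ⊥-elim (only-descent-at-c-impossible λ t<m t≢c dt →
                     ¬d0 (subst Descent (other-descent-at-0 t<m t≢c dt) dt))

    upper-half-ascending : Ascending (suc c) m
    upper-half-ascending = no-descent⇒ascending ≤-refl λ t c<t t<m dt →
      >⇒≢ (≤-trans (s≤s z≤n) c<t) (other-descent-at-0 t<m (>⇒≢ c<t) dt)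

    majorIndex≡c+2-impossible : ⊥
    majorIndex≡c+2-impossible = upper-half-ascending⇒¬descent₀
      (trans (sym (+-suc c c)) (sym m≡c+1+c)) 1≤c upper-half-ascending descent-at-0

  majorIndex≢c+2 : ∀ {c} → m ≡ c + suc c → majorIndex ≢ suc (suc c)
  majorIndex≢c+2 m≡c+1+c maj≡c+2 = majorIndex≡c+2-impossible m≡c+1+c maj≡c+2

  ascentTerm : ℕ → ℕ
  ascentTerm i = suc i ∸ descentTerm i

  majorIndex+ascentTerms : majorIndex + sumBelow m ascentTerm ≡ suc m C 2
  majorIndex+ascentTerms = begin
    majorIndex + sumBelow m ascentTerm                  ≡⟨ sumBelow-+ m descentTerm ascentTerm ⟩
    sumBelow m (λ i → descentTerm i + ascentTerm i)     ≡⟨ sumBelow-cong m (λ {i} _ → m+[n∸m]≡n (descentTerm≤ i)) ⟩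
    sumBelow m suc                                      ≡⟨ sumBelow-suc m ⟩
    suc m C 2                                           ∎
    where open ≡-Reasoning

  module _ (1≤m : 1 ≤ m) (maj≡top-1 : majorIndex ≡ suc m C 2 ∸ 1) where

    ascentTerms≡1 : sumBelow m ascentTerm ≡ 1
    ascentTerms≡1 = begin
      sumBelow m ascentTerm                                 ≡⟨ sym (m+n∸m≡n majorIndex _) ⟩
      majorIndex + sumBelow m ascentTerm ∸ majorIndex       ≡⟨ cong₂ _∸_ majorIndex+ascentTerms maj≡top-1 ⟩
      suc m C 2 ∸ (suc m C 2 ∸ 1)                           ≡⟨ m∸[m∸n]≡n 1≤top ⟩
      1                                                     ∎
      where
      open ≡-Reasoning
      1≤top : 1 ≤ suc m C 2
      1≤top = subst (1 ≤_) (sumBelow-suc m) (term≤sumBelow m suc 1≤m)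

    descending-from-1 : Descending 1 m
    descending-from-1 t 1≤t t<m with descent? t
    ... | yes dt  = dt
    ... | no ¬dt = contradiction (subst₂ _≤_ (cong (suc t ∸_) (descentTerm-¬descent ¬dt)) ascentTerms≡1
                                    (term≤sumBelow m ascentTerm t<m))
                                 (<⇒≱ (s≤s 1≤t))

    ¬descent₀ : ¬ Descent 0
    ¬descent₀ d0 = 0≢1+n (trans (sym (sumBelow-zero m no-ascent)) ascentTerms≡1)
      where
      no-ascent : ∀ {i} → i < m → ascentTerm i ≡ 0
      no-ascent {i} i<m = trans (cong (suc i ∸_) (descentTerm-descent (descent i i<m))) (n∸n≡0 (suc i))
        where
        descent : ∀ i → i < m → Descent i
        descent zero    _   = d0
        descent (suc i) i<m = descending-from-1 (suc i) (s≤s z≤n) i<m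

  majorIndex≢top-1 : 1 ≤ m → majorIndex ≢ suc m C 2 ∸ 1
  majorIndex≢top-1 1≤m maj≡top-1 =
    ¬descent₀ 1≤m maj≡top-1 (descending-tail⇒descent₀ 1≤m (descending-from-1 1≤m maj≡top-1))

majSum≡sumBelow : ∀ m {f : Fin m → ℕ} {g : ℕ → ℕ} → (∀ j → f j ≡ g (toℕ j)) → majSum m f ≡ sumBelow m g
majSum≡sumBelow zero    f≗g = refl
majSum≡sumBelow (suc m) {g = g} f≗g = cong₂ _+_
  (majSum≡sumBelow m λ j → trans (f≗g (inject₁ j)) (cong g (toℕ-inject₁ j)))
  (trans (f≗g (fromℕ m)) (cong g (toℕ-fromℕ m)))

-- Positions outside the domain are sent to the junk value 0.
asFunction : ∀ {n} → Permutation′ n → ℕ → ℕ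
asFunction {n} π i with i <? n
... | yes i<n = toℕ (π ⟨$⟩ʳ fromℕ< i<n)
... | no _    = 0

asFunction-toℕ : ∀ {n} (π : Permutation′ n) (x : Fin n) → asFunction π (toℕ x) ≡ val π x
asFunction-toℕ {n} π x with toℕ x <? n
... | yes x<n = cong (λ y → toℕ (π ⟨$⟩ʳ y)) (fromℕ<-toℕ x x<n)
... | no x≮n  = contradiction (toℕ<n x) x≮n

asFunction-< : ∀ {n} (π : Permutation′ n) {i} (i<n : i < n) → asFunction π i ≡ val π (fromℕ< i<n)
asFunction-< π i<n = trans (cong (asFunction π) (sym (toℕ-fromℕ< i<n))) (asFunction-toℕ π (fromℕ< i<n))

module FromPermutation {m} (π : Permutation′ (suc m)) (fpf-involution : IsFPFInvolution π) where

  private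
    P : ℕ → ℕ
    P = asFunction π

    bounded : ∀ {i} → i ≤ m → P i ≤ m
    bounded i≤m = subst (_≤ m) (sym (asFunction-< π (s≤s i≤m))) (≤-pred (toℕ<n _))

    involutive : ∀ {i} → i ≤ m → P (P i) ≡ i
    involutive {i} i≤m = begin
      P (P i)                    ≡⟨ cong P (asFunction-< π (s≤s i≤m)) ⟩
      P (toℕ (π ⟨$⟩ʳ x))         ≡⟨ asFunction-toℕ π (π ⟨$⟩ʳ x) ⟩
      toℕ (π ⟨$⟩ʳ (π ⟨$⟩ʳ x))    ≡⟨ cong toℕ (proj₁ fpf-involution x) ⟩
      toℕ x                      ≡⟨ toℕ-fromℕ< (s≤s i≤m) ⟩
      i                          ∎
      where
      open ≡-Reasoning
      x : Fin (suc m)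
      x = fromℕ< (s≤s i≤m)

    fixedPointFree : ∀ {i} → i ≤ m → P i ≢ i
    fixedPointFree {i} i≤m Pi≡i = proj₂ fpf-involution x (toℕ-injective (begin
      toℕ (π ⟨$⟩ʳ x)    ≡⟨ sym (asFunction-< π (s≤s i≤m)) ⟩
      P i               ≡⟨ Pi≡i ⟩
      i                 ≡⟨ sym (toℕ-fromℕ< (s≤s i≤m)) ⟩
      toℕ x             ∎))
      where
      open ≡-Reasoning
      x : Fin (suc m)
      x = fromℕ< (s≤s i≤m)

  open FixedPointFreeInvolution P m bounded involutive fixedPointFree public

  maj≡majorIndex : maj π ≡ majorIndex
  maj≡majorIndex = majSum≡sumBelow m λ j → cong₂ (λ a b → if does (a <? b) then suc (toℕ j) else 0)
    (sym (asFunction-toℕ π (fsuc j)))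
    (trans (sym (asFunction-toℕ π (inject₁ j))) (cong P (toℕ-inject₁ j)))

mainTheorem3 : (k : ℕ) → 1 ≤ k →
    ((π : Permutation′ (2 * k)) → IsFPFInvolution π → ¬ (maj π ≡ k + 1))
    × ((π : Permutation′ (2 * k)) → IsFPFInvolution π → ¬ (maj π ≡ ((2 * k) C 2) ∸ 1))
mainTheorem3 (suc c) _ = maj≢k+1 , maj≢top-1
  where
  m≡c+1+c : c + suc (c + 0) ≡ c + suc c
  m≡c+1+c = cong (λ x → c + suc x) (+-identityʳ c)

  maj≢k+1 : (π : Permutation′ (2 * suc c)) → IsFPFInvolution π → ¬ (maj π ≡ suc c + 1)
  maj≢k+1 π fpf-involution maj≡k+1 =
    majorIndex≢c+2 m≡c+1+c (trans (sym maj≡majorIndex) (trans maj≡k+1 (+-comm (suc c) 1)))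
    where open FromPermutation π fpf-involution

  maj≢top-1 : (π : Permutation′ (2 * suc c)) → IsFPFInvolution π → ¬ (maj π ≡ (2 * suc c) C 2 ∸ 1)
  maj≢top-1 π fpf-involution maj≡top-1 =
    majorIndex≢top-1 (≤-trans (s≤s z≤n) (m≤n+m (suc (c + 0)) c)) (trans (sym maj≡majorIndex) maj≡top-1)
    where open FromPermutation π fpf-involution
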